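{- Let $\sigma\in\mathfrak{S}_n$ and let $f=\phi^{ -1}(\sigma)$ be its nom code. Then $f$ is non-decreasing if and only if both of the following hold: (1) for any two anti-exceedances $i<j$ of $\sigma$ one has $\sigma(i)<\sigma(j)$; (2) for every $m\in[n]$, the set $\{i\in[n]:\mathrm{nom}_\sigma(i)=m\}$ is either empty or an interval of consecutive integers.
   Context: $[n]=\{1,\dots,n\}$, $\mathfrak{S}_n$ the symmetric group on $[n]$; products of permutations are composed with the leftmost factor acting first: $(\alpha\beta)(x)=\beta(\alpha(x))$. A function $f:[n]\to[n]$ is subexceedant if $1\le f(i)\le i$ for all $i$, written as the word $f_1\cdots f_n$; $F_n$ is the set of such functions. $\phi:F_n\to\mathfrak{S}_n$, $\phi(f)=(1,f_1)(2,f_2)\cdots(n,f_n)$ (with $(i,i)$ the identity), is a bijection; $\phi^{ -1}(\sigma)$ is the nom code of $\sigma$. $f$ is non-decreasing if $f_1\le\cdots\le f_n$. An anti-exceedance of $\sigma$ is an $i$ with $\sigma(i)\le i$. For $i\in[n]$, the nearest orbital minorant $\mathrm{nom}_\sigma(i)$ is $\sigma^t(i)$, where $t\ge1$ is the smallest positive integer with $\sigma^t(i)\le i$. -}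

module Defs where

open import Data.Nat as ℕ using (ℕ; zero; suc)
open import Data.Fin using (Fin; toℕ; _≤_; _<_; _≟_)
open import Data.Fin.Permutation using (Permutation′; _⟨$⟩ʳ_)
open import Data.List using (List; foldl; allFin)
open import Data.Product using (Σ; ∃; _×_; _,_)
open import Data.Sum using (_⊎_)
open import Relation.Nullary using (¬_; yes; no)
open import Relation.Binary.PropositionalEquality using (_≡_)
open import Function.Bundles using (_⇔_)

-- [n] is modelled by Fin n (0-based: element k of Fin n stands for k+1);
-- the order on Fin n is the order on toℕ, so all order notions are preserved.

Subexceedant : {n : ℕ} → (Fin n → Fin n) → Set
Subexceedant {n} f = ∀ (i : Fin n) → f i ≤ i

NonDecreasing : {n : ℕ} → (Fin n → Fin n) → Set
NonDecreasing {n} f = ∀ (i j : Fin n) → i ≤ j → f i ≤ f j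

transp : {n : ℕ} → Fin n → Fin n → Fin n → Fin n
transp a b x with x ≟ a
... | yes _ = b
... | no _ with x ≟ b
...   | yes _ = a
...   | no _ = x

-- φ(f) = (1,f_1)(2,f_2)⋯(n,f_n), products composed with the leftmost
-- factor acting first: φ(f)(x) = (n,f_n)(⋯((1,f_1)(x))).
phi : {n : ℕ} → (Fin n → Fin n) → Fin n → Fin n
phi {n} f x = foldl (λ y k → transp k (f k) y) x (allFin n)

iter : {n : ℕ} → Permutation′ n → ℕ → Fin n → Fin n
iter σ zero x = x
iter σ (suc t) x = σ ⟨$⟩ʳ (iter σ t x)

AntiExc : {n : ℕ} → Permutation′ n → Fin n → Set
AntiExc σ i = σ ⟨$⟩ʳ i ≤ i

NomIs : {n : ℕ} → Permutation′ n → Fin n → Fin n → Set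
NomIs σ i m =
  Σ ℕ λ t → (1 ℕ.≤ t) × (iter σ t i ≡ m) × (iter σ t i ≤ i)
          × (∀ s → 1 ℕ.≤ s → s ℕ.< t → ¬ (iter σ s i ≤ i))

Cond1 : {n : ℕ} → Permutation′ n → Set
Cond1 {n} σ = ∀ (i j : Fin n) → AntiExc σ i → AntiExc σ j → i < j
              → σ ⟨$⟩ʳ i < σ ⟨$⟩ʳ j

Cond2 : {n : ℕ} → Permutation′ n → Set
Cond2 {n} σ = ∀ (m : Fin n) →
  (∀ (i : Fin n) → ¬ NomIs σ i m)
  ⊎ (Σ (Fin n) λ a → Σ (Fin n) λ b → a ≤ b ×
       (∀ (i : Fin n) → NomIs σ i m ⇔ (a ≤ i × i ≤ b)))

-- Build φ(f) from the left.  After the first k factors the partial product g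
-- fixes every point ≥ k, and the next factor (k, f k) with f k ≤ k splices the
-- fixed point k into the g-orbit just before f k.  Orbit segments that stay
-- above some i < k merely pass through k, so their first point ≤ i is
-- unchanged, while k itself now steps directly to f k ≤ k.  Hence
-- nom_σ(i) = f(i): the nom code records the nearest orbital minorants.
--
-- Both conditions then concern f.  The last step of the orbit from i to
-- nom_σ(i) starts at an anti-exceedance e ≥ i with σ(e) = f(i), and on
-- anti-exceedances σ = f; so (1) is monotonicity of f on anti-exceedances,
-- and (2) says that the fibres of f are intervals.  Conversely, if i ≤ j but
-- f j < f i, compare the anti-exceedances e_i, e_j: e_i < e_j violates (1),
-- and e_j < e_i puts j between i and e_i in the fibre of f i, violating (2).
module Submission where

open import Defs
open import Data.Nat as ℕ using (ℕ; zero; suc; z≤n; s≤s)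
import Data.Nat.Properties as ℕₚ
open import Data.Fin using (Fin; toℕ; fromℕ<; _≟_; _≤_; _<_)
import Data.Fin.Properties as Fin
open import Data.Fin.Permutation using (Permutation′; _⟨$⟩ʳ_)
open import Data.List using (foldl; allFin; take)
open import Data.List.Properties using (foldl-∷ʳ; take-suc-tabulate; take-all; length-tabulate)
open import Data.Product using (Σ; ∃-syntax; _×_; _,_; proj₁; proj₂)
open import Data.Sum using (_⊎_; inj₁; inj₂)
open import Data.Empty using (⊥; ⊥-elim)
open import Function using (_∘_; id)
open import Function.Bundles using (_⇔_; mk⇔; Equivalence; Injection)
open import Function.Properties.Inverse using (↔⇒↣)
open import Function.Construct.Composition using (_⇔-∘_)
open import Function.Construct.Symmetry using (⇔-sym)
open import Relation.Nullary using (¬_; yes; no)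
open import Relation.Unary using (Pred; Decidable)
open import Relation.Binary.Definitions using (tri<; tri≈; tri>)
open import Relation.Binary.PropositionalEquality
  using (_≡_; _≢_; refl; sym; trans; cong; subst; subst₂)

private
  variable
    n : ℕ

transp-left : (a b : Fin n) → transp a b a ≡ b
transp-left a b with a ≟ a
... | yes _   = refl
... | no  a≢a = ⊥-elim (a≢a refl)

transp-right : (a b : Fin n) → transp a b b ≡ a
transp-right a b with b ≟ a
... | yes b≡a = b≡a
... | no  _ with b ≟ b
...   | yes _   = refl
...   | no  b≢b = ⊥-elim (b≢b refl)

transp-other : (a b : Fin n) {x : Fin n} → x ≢ a → x ≢ b → transp a b x ≡ x
transp-other a b {x} x≢a x≢b with x ≟ a
... | yes x≡a = ⊥-elim (x≢a x≡a)
... | no  _ with x ≟ b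
...   | yes x≡b = ⊥-elim (x≢b x≡b)
...   | no  _   = refl

data NomPath (g : Fin n → Fin n) (i : Fin n) : Fin n → Fin n → Set where
  arrive : ∀ {x m} → g x ≡ m → m ≤ i → NomPath g i x m
  pass   : ∀ {x m} → i < g x → NomPath g i (g x) m → NomPath g i x m

pass-via : ∀ {g : Fin n → Fin n} {i x y m} →
           g x ≡ y → i < y → NomPath g i y m → NomPath g i x m
pass-via refl = pass

module _ {g : Fin n → Fin n} {i : Fin n} where

  fixedPoint-¬NomPath : ∀ {x m} → g x ≡ x → i < x → ¬ NomPath g i x m
  fixedPoint-¬NomPath gx≡x i<x (arrive gx≡m m≤i) =
    ℕₚ.<⇒≱ i<x (subst (_≤ i) (trans (sym gx≡m) gx≡x) m≤i)
  fixedPoint-¬NomPath gx≡x _ (pass i<gx path) = fixedPoint-¬NomPath (cong g gx≡x) i<gx path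

  NomPath-cong : ∀ {h} → (∀ x → g x ≡ h x) →
                 ∀ {x m} → NomPath g i x m → NomPath h i x m
  NomPath-cong g≗h {x} (arrive gx≡m m≤i) = arrive (trans (sym (g≗h x)) gx≡m) m≤i
  NomPath-cong g≗h {x} (pass i<gx path)  = pass-via (sym (g≗h x)) i<gx (NomPath-cong g≗h path)

  NomPath-splice : ∀ {g′ K c} → g K ≡ K → i < K → (∀ y → g′ y ≡ transp K c (g y)) →
                   ∀ {x m} → NomPath g i x m → NomPath g′ i x m
  NomPath-splice {g′} {K} {c} gK≡K i<K g′≡ = splice
    where
    g′K≡c : g′ K ≡ c
    g′K≡c = trans (g′≡ K) (trans (cong (transp K c) gK≡K) (transp-left K c))

    g′x≡K : ∀ {x} → g x ≡ c → g′ x ≡ K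
    g′x≡K {x} gx≡c = trans (g′≡ x) (trans (cong (transp K c) gx≡c) (transp-right K c))

    g′x≡gx : ∀ {x} → g x ≢ K → g x ≢ c → g′ x ≡ g x
    g′x≡gx {x} gx≢K gx≢c = trans (g′≡ x) (transp-other K c gx≢K gx≢c)

    splice : ∀ {x m} → NomPath g i x m → NomPath g′ i x m
    splice {x} (arrive gx≡m m≤i) with g x ≟ K | g x ≟ c
    ... | yes gx≡K | _        =
      ⊥-elim (ℕₚ.<⇒≱ i<K (subst (_≤ i) (trans (sym gx≡m) gx≡K) m≤i))
    ... | no  _    | yes gx≡c =
      pass-via (g′x≡K gx≡c) i<K (arrive (trans g′K≡c (trans (sym gx≡c) gx≡m)) m≤i)
    ... | no  gx≢K | no  gx≢c = arrive (trans (g′x≡gx gx≢K gx≢c) gx≡m) m≤i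
    splice {x} (pass i<gx path) with g x ≟ K | g x ≟ c
    ... | yes gx≡K | _        =
      ⊥-elim (fixedPoint-¬NomPath gK≡K i<K (subst (λ y → NomPath g i y _) gx≡K path))
    ... | no  _    | yes gx≡c =
      pass-via (g′x≡K gx≡c) i<K (pass-via (trans g′K≡c (sym gx≡c)) i<gx (splice path))
    ... | no  gx≢K | no  gx≢c = pass-via (g′x≡gx gx≢K gx≢c) i<gx (splice path)

module _ (f : Fin n → Fin n) where

  factor : Fin n → Fin n → Fin n
  factor y k = transp k (f k) y

  partialPhi : ℕ → Fin n → Fin n
  partialPhi k x = foldl factor x (take k (allFin n))

  phi≗partialPhi : ∀ x → phi f x ≡ partialPhi n x
  phi≗partialPhi x =
    cong (foldl factor x) (sym (take-all n (allFin n) (ℕₚ.≤-reflexive (length-tabulate id))))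

  partialPhi-suc : ∀ (k : Fin n) x →
                   partialPhi (suc (toℕ k)) x ≡ transp k (f k) (partialPhi (toℕ k) x)
  partialPhi-suc k x = trans (cong (foldl factor x) (take-suc-tabulate id k))
                             (foldl-∷ʳ factor x k (take (toℕ k) (allFin n)))

  PartialNomCode : ℕ → (Fin n → Fin n) → Set
  PartialNomCode k g =
    (∀ x → k ℕ.≤ toℕ x → g x ≡ x) × (∀ i → toℕ i ℕ.< k → NomPath g i i (f i))

  PartialNomCode-suc : Subexceedant f → ∀ {g g′} (K : Fin n) → PartialNomCode (toℕ K) g →
                       (∀ y → g′ y ≡ transp K (f K) (g y)) → PartialNomCode (suc (toℕ K)) g′
  PartialNomCode-suc sub {g} {g′} K (fixes , paths) g′≡ = fixes′ , paths′
    where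
    gK≡K : g K ≡ K
    gK≡K = fixes K ℕₚ.≤-refl

    fixes′ : ∀ x → K < x → g′ x ≡ x
    fixes′ x K<x = trans (g′≡ x) (trans (cong (transp K (f K)) (fixes x (ℕₚ.<⇒≤ K<x)))
      (transp-other K (f K) (Fin.<⇒≢ K<x ∘ sym) (Fin.<⇒≢ (ℕₚ.≤-<-trans (sub K) K<x) ∘ sym)))

    paths′ : ∀ i → toℕ i ℕ.< suc (toℕ K) → NomPath g′ i i (f i)
    paths′ i i<1+K with ℕₚ.m<1+n⇒m<n∨m≡n i<1+K
    ... | inj₁ i<K = NomPath-splice gK≡K i<K g′≡ (paths i i<K)
    ... | inj₂ i≡K rewrite Fin.toℕ-injective i≡K =
      arrive (trans (g′≡ K) (trans (cong (transp K (f K)) gK≡K) (transp-left K (f K)))) (sub K)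

  partialNomCode : Subexceedant f → ∀ k → k ℕ.≤ n → PartialNomCode k (partialPhi k)
  partialNomCode sub zero    _   = (λ _ _ → refl) , λ _ ()
  partialNomCode sub (suc k) k<n with fromℕ< k<n | Fin.toℕ-fromℕ< k<n
  ... | K | refl =
    PartialNomCode-suc sub K (partialNomCode sub (toℕ K) (ℕₚ.<⇒≤ k<n)) (partialPhi-suc K)

iter-suc′ : (σ : Permutation′ n) (t : ℕ) (x : Fin n) →
            iter σ t (σ ⟨$⟩ʳ x) ≡ iter σ (suc t) x
iter-suc′ σ zero    x = refl
iter-suc′ σ (suc t) x = cong (σ ⟨$⟩ʳ_) (iter-suc′ σ t x)

module _ (σ : Permutation′ n) where

  NomPath⇒iter : ∀ {i x m} → NomPath (σ ⟨$⟩ʳ_) i x m →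
    Σ ℕ λ t → (1 ℕ.≤ t) × (iter σ t x ≡ m) × (iter σ t x ≤ i)
            × (∀ s → 1 ℕ.≤ s → s ℕ.< t → ¬ (iter σ s x ≤ i))
  NomPath⇒iter {i} (arrive σx≡m m≤i) =
    1 , s≤s z≤n , σx≡m , subst (_≤ i) (sym σx≡m) m≤i , λ s 1≤s s<1 → ⊥-elim (ℕₚ.<⇒≱ s<1 1≤s)
  NomPath⇒iter {i} {x} (pass i<σx path) with NomPath⇒iter path
  ... | t , _ , σᵗ⁺¹x≡m , σᵗ⁺¹x≤i , above =
    suc t , s≤s z≤n , trans (sym (iter-suc′ σ t x)) σᵗ⁺¹x≡m ,
    subst (_≤ i) (iter-suc′ σ t x) σᵗ⁺¹x≤i , above′
    where
    above′ : ∀ s → 1 ℕ.≤ s → s ℕ.< suc t → ¬ (iter σ s x ≤ i)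
    above′ (suc zero)    _ _         = ℕₚ.<⇒≱ i<σx
    above′ (suc (suc s)) _ (s≤s s<t) =
      subst (λ y → ¬ (y ≤ i)) (iter-suc′ σ (suc s) x) (above (suc s) (s≤s z≤n) s<t)

nomCode : {σ : Permutation′ n} {f : Fin n → Fin n} → Subexceedant f →
          (∀ x → phi f x ≡ σ ⟨$⟩ʳ x) → ∀ i → NomIs σ i (f i)
nomCode {n} {σ} {f} sub phi≗σ i =
  NomPath⇒iter σ (NomPath-cong partialPhi≗σ
    (proj₂ (partialNomCode f sub n ℕₚ.≤-refl) i (Fin.toℕ<n i)))
  where
  partialPhi≗σ : ∀ x → partialPhi f n x ≡ σ ⟨$⟩ʳ x
  partialPhi≗σ x = trans (sym (phi≗partialPhi f x)) (phi≗σ x)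

module _ {σ : Permutation′ n} where

  NomIs-functional : ∀ {i m m′} → NomIs σ i m → NomIs σ i m′ → m ≡ m′
  NomIs-functional (t , 1≤t , σᵗi≡m , σᵗi≤i , above) (t′ , 1≤t′ , σᵗ′i≡m′ , σᵗ′i≤i , above′)
    with ℕₚ.<-cmp t t′
  ... | tri< t<t′ _ _ = ⊥-elim (above′ t 1≤t t<t′ σᵗi≤i)
  ... | tri≈ _ refl _ = trans (sym σᵗi≡m) σᵗ′i≡m′
  ... | tri> _ _ t′<t = ⊥-elim (above t′ 1≤t′ t′<t σᵗ′i≤i)

  antiExc⇒NomIs : ∀ {i} → AntiExc σ i → NomIs σ i (σ ⟨$⟩ʳ i)
  antiExc⇒NomIs σi≤i = 1 , s≤s z≤n , refl , σi≤i , λ s 1≤s s<1 → ⊥-elim (ℕₚ.<⇒≱ s<1 1≤s)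

  NomIs⇒antiExc : ∀ {i m} → NomIs σ i m → ∃[ e ] i ≤ e × σ ⟨$⟩ʳ e ≡ m × AntiExc σ e
  NomIs⇒antiExc {i} (suc t , _ , σᵗ⁺¹i≡m , σᵗ⁺¹i≤i , above) =
    iter σ t i , i≤σᵗi t above , σᵗ⁺¹i≡m , Fin.≤-trans σᵗ⁺¹i≤i (i≤σᵗi t above)
    where
    i≤σᵗi : ∀ k → (∀ s → 1 ℕ.≤ s → s ℕ.< suc k → ¬ (iter σ s i ≤ i)) → i ≤ iter σ k i
    i≤σᵗi zero    _        = Fin.≤-refl
    i≤σᵗi (suc k) aboveᵏ⁺¹ = ℕₚ.<⇒≤ (ℕₚ.≰⇒> (aboveᵏ⁺¹ (suc k) (s≤s z≤n) ℕₚ.≤-refl))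

search-least : ∀ {n p} {P : Pred (Fin n) p} → Decidable P →
               (∀ i → ¬ P i) ⊎ ∃[ a ] P a × (∀ j → P j → a ≤ j)
search-least {zero}  P? = inj₁ λ ()
search-least {suc n} P? with P? Fin.zero | search-least (P? ∘ Fin.suc)
... | yes P0 | _                      = inj₂ (Fin.zero , P0 , λ _ _ → z≤n)
... | no ¬P0 | inj₁ none              = inj₁ λ { Fin.zero → ¬P0 ; (Fin.suc j) → none j }
... | no ¬P0 | inj₂ (a , Pa , least) =
  inj₂ (Fin.suc a , Pa , λ { Fin.zero P0 → ⊥-elim (¬P0 P0) ; (Fin.suc j) Pj → s≤s (least j Pj) })

search-greatest : ∀ {n p} {P : Pred (Fin n) p} → Decidable P →
                  (∀ i → ¬ P i) ⊎ ∃[ b ] P b × (∀ j → P j → j ≤ b)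
search-greatest {zero}  P? = inj₁ λ ()
search-greatest {suc n} P? with search-greatest (P? ∘ Fin.suc) | P? Fin.zero
... | inj₂ (b , Pb , greatest) | _ =
  inj₂ (Fin.suc b , Pb , λ { Fin.zero _ → z≤n ; (Fin.suc j) Pj → s≤s (greatest j Pj) })
... | inj₁ none | yes P0 =
  inj₂ (Fin.zero , P0 , λ { Fin.zero _ → z≤n ; (Fin.suc j) Pj → ⊥-elim (none j Pj) })
... | inj₁ none | no ¬P0 = inj₁ λ { Fin.zero → ¬P0 ; (Fin.suc j) → none j }

EmptyOrInterval : ∀ {ℓ} → Pred (Fin n) ℓ → Set ℓ
EmptyOrInterval {n} P =
  (∀ i → ¬ P i) ⊎ Σ (Fin n) λ a → Σ (Fin n) λ b → a ≤ b × (∀ i → P i ⇔ (a ≤ i × i ≤ b))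

module _ {ℓ} {P : Pred (Fin n) ℓ} where

  EmptyOrInterval-resp : ∀ {Q : Pred (Fin n) ℓ} → (∀ i → P i ⇔ Q i) →
                         EmptyOrInterval P → EmptyOrInterval Q
  EmptyOrInterval-resp P⇔Q (inj₁ empty) = inj₁ λ i → empty i ∘ Equivalence.from (P⇔Q i)
  EmptyOrInterval-resp P⇔Q (inj₂ (a , b , a≤b , P⇔[a,b])) =
    inj₂ (a , b , a≤b , λ i → P⇔[a,b] i ⇔-∘ ⇔-sym (P⇔Q i))

  EmptyOrInterval-convex : EmptyOrInterval P → ∀ {i j k} → P i → P k → i ≤ j → j ≤ k → P j
  EmptyOrInterval-convex (inj₁ empty) {i} Pi _ _ _ = ⊥-elim (empty i Pi)
  EmptyOrInterval-convex (inj₂ (a , b , _ , P⇔[a,b])) {i} {j} {k} Pi Pk i≤j j≤k =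
    Equivalence.from (P⇔[a,b] j)
      (Fin.≤-trans (proj₁ (Equivalence.to (P⇔[a,b] i) Pi)) i≤j ,
       Fin.≤-trans j≤k (proj₂ (Equivalence.to (P⇔[a,b] k) Pk)))

nonDecreasing-fibre : {f : Fin n → Fin n} → NonDecreasing f → ∀ m → EmptyOrInterval (λ i → f i ≡ m)
nonDecreasing-fibre {f = f} mono m
  with search-least (λ i → f i ≟ m) | search-greatest (λ i → f i ≟ m)
... | inj₁ empty                | _                             = inj₁ empty
... | inj₂ (a , fa≡m , _)       | inj₁ empty                    = ⊥-elim (empty a fa≡m)
... | inj₂ (a , fa≡m , a-least) | inj₂ (b , fb≡m , b-greatest) =
  inj₂ (a , b , a-least b fb≡m , λ i →
    mk⇔ (λ fi≡m → a-least i fi≡m , b-greatest i fi≡m)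
        (λ (a≤i , i≤b) → Fin.≤-antisym (subst (f i ≤_) fb≡m (mono i b i≤b))
                                        (subst (_≤ f i) fa≡m (mono a i a≤i))))

module _ {σ : Permutation′ n} {f : Fin n → Fin n} (nom : ∀ i → NomIs σ i (f i)) where

  NomIs⇔nomCode : ∀ {i m} → NomIs σ i m ⇔ f i ≡ m
  NomIs⇔nomCode {i} = mk⇔ (NomIs-functional (nom i)) (λ { refl → nom i })

  antiExc⇒σ≡nomCode : ∀ {i} → AntiExc σ i → σ ⟨$⟩ʳ i ≡ f i
  antiExc⇒σ≡nomCode {i} σi≤i = NomIs-functional (antiExc⇒NomIs σi≤i) (nom i)

  nonDecreasing⇒cond1 : NonDecreasing f → Cond1 σ
  nonDecreasing⇒cond1 mono i j σi≤i σj≤j i<j = Fin.≤∧≢⇒< σi≤σj (Fin.<⇒≢ i<j ∘ σ-injective)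
    where
    σ-injective : ∀ {x y} → σ ⟨$⟩ʳ x ≡ σ ⟨$⟩ʳ y → x ≡ y
    σ-injective = Injection.injective (↔⇒↣ σ)
    σi≤σj : σ ⟨$⟩ʳ i ≤ σ ⟨$⟩ʳ j
    σi≤σj = subst₂ _≤_ (sym (antiExc⇒σ≡nomCode σi≤i)) (sym (antiExc⇒σ≡nomCode σj≤j))
                       (mono i j (ℕₚ.<⇒≤ i<j))

  nonDecreasing⇒cond2 : NonDecreasing f → Cond2 σ
  nonDecreasing⇒cond2 mono m =
    EmptyOrInterval-resp (λ _ → ⇔-sym NomIs⇔nomCode) (nonDecreasing-fibre mono m)

  cond1∧cond2⇒nonDecreasing : Cond1 σ → Cond2 σ → NonDecreasing f
  cond1∧cond2⇒nonDecreasing cond1 cond2 i j i≤j =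
    ℕₚ.≮⇒≥ (λ fj<fi → ¬descent fj<fi (NomIs⇒antiExc (nom i)) (NomIs⇒antiExc (nom j)))
    where
    ¬descent : f j < f i → ∃[ e ] i ≤ e × σ ⟨$⟩ʳ e ≡ f i × AntiExc σ e →
              ∃[ e ] j ≤ e × σ ⟨$⟩ʳ e ≡ f j × AntiExc σ e → ⊥
    ¬descent fj<fi (eᵢ , i≤eᵢ , σeᵢ≡fi , σeᵢ≤eᵢ) (eⱼ , j≤eⱼ , σeⱼ≡fj , σeⱼ≤eⱼ)
      with Fin.<-cmp eᵢ eⱼ
    ... | tri< eᵢ<eⱼ _ _ =
      Fin.<-asym fj<fi (subst₂ _<_ σeᵢ≡fi σeⱼ≡fj (cond1 eᵢ eⱼ σeᵢ≤eᵢ σeⱼ≤eⱼ eᵢ<eⱼ))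
    ... | tri≈ _ refl _  = Fin.<-irrefl (trans (sym σeⱼ≡fj) σeᵢ≡fi) fj<fi
    ... | tri> _ _ eⱼ<eᵢ = Fin.<-irrefl (Equivalence.to NomIs⇔nomCode j-nom-fi) fj<fi
      where
      j-nom-fi : NomIs σ j (f i)
      j-nom-fi = EmptyOrInterval-convex (cond2 (f i)) (nom i)
        (subst (NomIs σ eᵢ) σeᵢ≡fi (antiExc⇒NomIs σeᵢ≤eᵢ)) i≤j (ℕₚ.<⇒≤ (ℕₚ.≤-<-trans j≤eⱼ eⱼ<eᵢ))

proposition4p3 : (n : ℕ) (σ : Permutation′ n) (f : Fin n → Fin n) →
    Subexceedant f → (∀ (x : Fin n) → phi f x ≡ σ ⟨$⟩ʳ x) →
    (NonDecreasing f ⇔ (Cond1 σ × Cond2 σ))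
proposition4p3 n σ f sub phi≗σ =
  mk⇔ (λ mono → nonDecreasing⇒cond1 nom mono , nonDecreasing⇒cond2 nom mono)
      (λ (cond1 , cond2) → cond1∧cond2⇒nonDecreasing nom cond1 cond2)
  where
  nom : ∀ i → NomIs σ i (f i)
  nom = nomCode sub phi≗σ
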